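{- Let $p\ge 5$ be a prime. Then $g_p(2^k)\le 2^{k+1}$ for all integers $k\ge 0$.
   Context: $\mathbb{N}=\{0,1,2,\dots\}$. For an integer $m\ge 2$, an $m$-product sequence is a finite sequence of integers $a_1\le a_2\le\dots\le a_t$ such that $\prod_{i=1}^t a_i=R^m$ for some $R\in\mathbb{N}$ and no integer appears more than $m-1$ times in the sequence. For $n\in\mathbb{N}$, $g_m(n)$ is the least integer $s$ such that there exists an $m$-product sequence $a_1\le\dots\le a_t$ with $a_1=n$ and $a_t=s$. -}

module Defs where

open import Data.Nat using (ℕ; _≤_; _^_; _∸_)
open import Data.List using (List; []; _∷_; last)
open import Data.Nat.ListAction using (product)
open import Data.Nat.Properties using (≤-totalOrder)
open import Data.List.Relation.Unary.Sorted.TotalOrder ≤-totalOrder using (Sorted)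
open import Data.List.Relation.Unary.All using (All)
open import Data.Maybe using (just)
open import Data.Nat.Properties using (_≟_)
open import Data.Product using (∃; _×_)
open import Relation.Binary.PropositionalEquality using (_≡_)
open import Relation.Nullary using (yes; no)
open import Data.Nat using (suc)

count : ℕ → List ℕ → ℕ
count a [] = 0
count a (x ∷ xs) with x ≟ a
... | yes _ = suc (count a xs)
... | no _ = count a xs

-- An m-product sequence a₁ ≤ … ≤ a_t, given as a (nonempty) list.
-- Since in this paper a₁ = n ∈ ℕ and the sequence is nondecreasing,
-- all entries are natural numbers.
record ProductSeq (m : ℕ) (as : List ℕ) : Set where
  field
    sorted     : Sorted as
    isPower    : ∃ λ R → product as ≡ R ^ m
    multBound  : All (λ a → count a as ≤ m ∸ 1) as

IsG : ℕ → ℕ → ℕ → Set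
IsG m n s =
  (∃ λ rest → ProductSeq m (n ∷ rest) × last (n ∷ rest) ≡ just s)
  × (∀ rest s′ → ProductSeq m (n ∷ rest) → last (n ∷ rest) ≡ just s′ → s ≤ s′)

-- Write k = r + q p with 0 ≤ r < p and exhibit an explicit p-product sequence from 2^k
-- that ends at most at 2^(k+1):
--   r = 0:          2^k alone, since 2^(qp) is a p-th power;
--   1 ≤ r ≤ p − 2:  2^k taken r + 1 times and 2^(k+1) taken p − r times;
--   r = p − 1:      2^m · (16, 24, …, 24, 27) with p − 3 copies of 24, where k = m + 4.
-- In each case the exponents of 2 and 3 in the product are multiples of p.  Since every
-- entry of a sequence ending at s is at most s and occurs fewer than p times, sequences
-- ending at s can be searched exhaustively, so g_p(2^k) exists and is at most the end point.
module Submission where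

open import Defs
open import Data.Nat using (ℕ; zero; suc; _+_; _*_; _∸_; _^_; _≤_; _<_; z≤n; s≤s; s≤s⁻¹; z<s; _≤?_; NonZero)
open import Data.Nat.Properties
open import Data.Nat.DivMod using (_/_; _%_; m≡m%n+[m/n]*n; m%n<n)
open import Data.Nat.Induction using (<-wellFounded)
open import Data.Nat.ListAction using (product)
open import Data.Nat.ListAction.Properties using (product-++)
open import Data.Nat.Primality using (Prime)
open import Data.Nat.Tactic.RingSolver using (solve-∀)
open import Data.List using (List; []; _∷_; _++_; length; replicate; last; map; foldr)
open import Data.List.Properties using (length-replicate)
open import Data.List.Membership.Propositional using (_∈_)
open import Data.List.Relation.Unary.Any using (here; there)
open import Data.List.Relation.Unary.All as All using (All; []; _∷_)
open import Data.List.Relation.Unary.All.Properties using (replicate⁺; ++⁺)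
open import Data.List.Relation.Unary.AllPairs using (AllPairs; []; _∷_)
import Data.List.Relation.Unary.AllPairs.Properties as AllPairs
open import Data.List.Relation.Unary.Linked using (Linked; []; [-]; _∷_)
open import Data.List.Relation.Unary.Linked.Properties using (Linked⇒AllPairs)
open import Data.List.Relation.Unary.Sorted.TotalOrder ≤-totalOrder using (Sorted; sorted?)
open import Data.List.Relation.Unary.Sorted.TotalOrder.Properties using (AllPairs⇒Sorted)
open import Data.Maybe using (just)
open import Data.Maybe.Properties using (≡-dec)
open import Data.Product using (∃; _×_; _,_; proj₁)
open import Data.Sum using (_⊎_; inj₁; inj₂)
open import Induction.WellFounded using (Acc; acc)
open import Relation.Nullary using (Dec; yes; no; contradiction)
open import Relation.Nullary.Decidable using (map′; _×-dec_; _⊎-dec_)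
open import Relation.Unary using (Decidable)
open import Relation.Binary.PropositionalEquality using (_≡_; _≢_; refl; sym; trans; cong; cong₂; subst; module ≡-Reasoning)

count-++ : ∀ v xs ys → count v (xs ++ ys) ≡ count v xs + count v ys
count-++ v []       ys = refl
count-++ v (x ∷ xs) ys with x ≟ v
... | yes _ = cong suc (count-++ v xs ys)
... | no  _ = count-++ v xs ys

count-≤-length : ∀ v xs → count v xs ≤ length xs
count-≤-length v []       = z≤n
count-≤-length v (x ∷ xs) with x ≟ v
... | yes _ = s≤s (count-≤-length v xs)
... | no  _ = m≤n⇒m≤1+n (count-≤-length v xs)

count-≡0 : ∀ {v} xs → All (_≢ v) xs → count v xs ≡ 0
count-≡0 []       []              = refl
count-≡0 {v} (x ∷ xs) (x≢v ∷ xs≢v) with x ≟ v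
... | yes x≡v = contradiction x≡v x≢v
... | no  _   = count-≡0 xs xs≢v

count>0⇒∈ : ∀ {v} xs → 0 < count v xs → v ∈ xs
count>0⇒∈ {v} (x ∷ xs) count>0 with x ≟ v
... | yes refl = here refl
... | no  _    = there (count>0⇒∈ xs count>0)

count-∷-≤ : ∀ v x xs → count v xs ≤ count v (x ∷ xs)
count-∷-≤ v x xs with x ≟ v
... | yes _ = n≤1+n _
... | no  _ = ≤-refl

All-count-≤⇒count-≤ : ∀ {B} xs → All (λ a → count a xs ≤ B) xs → ∀ v → count v xs ≤ B
All-count-≤⇒count-≤ xs bound v with count v xs in eq
... | zero  = z≤n
... | suc _ = subst (_≤ _) eq (All.lookup bound (count>0⇒∈ xs (subst (0 <_) (sym eq) z<s)))

-- Pigeonhole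

countBelow : ℕ → List ℕ → ℕ
countBelow zero    xs = 0
countBelow (suc b) xs = count b xs + countBelow b xs

countBelow-∷-≤ : ∀ b x xs → countBelow b xs ≤ countBelow b (x ∷ xs)
countBelow-∷-≤ zero    x xs = z≤n
countBelow-∷-≤ (suc b) x xs = +-mono-≤ (count-∷-≤ b x xs) (countBelow-∷-≤ b x xs)

countBelow-∷-< : ∀ {b x} xs → x < b → countBelow b xs < countBelow b (x ∷ xs)
countBelow-∷-< {suc b} {x} xs x<1+b with x ≟ b
... | yes refl = s≤s (+-monoʳ-≤ (count x xs) (countBelow-∷-≤ b x xs))
... | no  x≢b  = ≤-trans (≤-reflexive (sym (+-suc (count b xs) _)))
                   (+-monoʳ-≤ (count b xs) (countBelow-∷-< xs (≤∧≢⇒< (s≤s⁻¹ x<1+b) x≢b)))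

length≤countBelow : ∀ {b} xs → All (_< b) xs → length xs ≤ countBelow b xs
length≤countBelow []       []           = z≤n
length≤countBelow (x ∷ xs) (x<b ∷ xs<b) = ≤-trans (s≤s (length≤countBelow xs xs<b)) (countBelow-∷-< xs x<b)

countBelow-≤ : ∀ b {B} xs → (∀ v → count v xs ≤ B) → countBelow b xs ≤ b * B
countBelow-≤ zero    xs bound = z≤n
countBelow-≤ (suc b) xs bound = +-mono-≤ (bound b) (countBelow-≤ b xs bound)

length-≤-* : ∀ {b B} xs → All (_< b) xs → (∀ v → count v xs ≤ B) → length xs ≤ b * B
length-≤-* {b} xs xs<b bound = ≤-trans (length≤countBelow xs xs<b) (countBelow-≤ b xs bound)

sorted⇒All≤last : ∀ {xs s} → Sorted xs → last xs ≡ just s → All (_≤ s) xs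
sorted⇒All≤last [-] refl = ≤-refl ∷ []
sorted⇒All≤last {_ ∷ ys} {s} (x≤y ∷ sorted) eq = ≤-trans x≤y (All.head ys≤s) ∷ ys≤s
  where
  ys≤s : All (_≤ s) ys
  ys≤s = sorted⇒All≤last sorted eq

-- Existence of g by exhaustive search

ProductSeqFromTo : ℕ → ℕ → ℕ → Set
ProductSeqFromTo m n s = ∃ λ rest → ProductSeq m (n ∷ rest) × last (n ∷ rest) ≡ just s

ReachesWithin : ℕ → ℕ → ℕ → Set
ReachesWithin m n b = ∃ λ s → ProductSeqFromTo m n s × s ≤ b

productSeq-bounded : ∀ {m xs s} → ProductSeq m xs → last xs ≡ just s →
                     All (_< suc s) xs × length xs ≤ suc s * (m ∸ 1)
productSeq-bounded {xs = xs} {s} seq eq =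
  xs<s , length-≤-* xs xs<s (All-count-≤⇒count-≤ xs (ProductSeq.multBound seq))
  where
  xs<s : All (_< suc s) xs
  xs<s = All.map s≤s (sorted⇒All≤last (ProductSeq.sorted seq) eq)

m≤m^n : ∀ m {n} → 1 ≤ n → m ≤ m ^ n
m≤m^n zero        _ = z≤n
m≤m^n m@(suc _) {suc n} _ = m≤m*n m (m ^ n) {{m^n≢0 m n}}

perfectPower? : ∀ {m} → 1 ≤ m → Decidable (λ P → ∃ λ R → P ≡ R ^ m)
perfectPower? {m} 1≤m P =
  map′ (λ (R , _ , P≡R^m) → R , P≡R^m)
       (λ (R , P≡R^m) → R , s≤s (subst (R ≤_) (sym P≡R^m) (m≤m^n R 1≤m)) , P≡R^m)
       (anyUpTo? (λ R → P ≟ R ^ m) (suc P))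

productSeq? : ∀ {m} → 1 ≤ m → Decidable (ProductSeq m)
productSeq? {m} 1≤m as =
  map′ (λ (sorted , isPower , multBound) →
          record { sorted = sorted ; isPower = isPower ; multBound = multBound })
       (λ seq → ProductSeq.sorted seq , ProductSeq.isPower seq , ProductSeq.multBound seq)
       (sorted? _≤?_ as ×-dec perfectPower? 1≤m (product as)
          ×-dec All.all? (λ a → count a as ≤? m ∸ 1) as)

ExistsBoundedList : (List ℕ → Set) → ℕ → ℕ → Set
ExistsBoundedList P b L = ∃ λ xs → All (_< b) xs × length xs ≤ L × P xs

boundedList? : ∀ {P : List ℕ → Set} → Decidable P → ∀ b L → Dec (ExistsBoundedList P b L)
boundedList? {P} P? b zero = map′ (λ p → [] , [] , z≤n , p) from (P? [])
  where
  from : ExistsBoundedList P b 0 → P []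
  from ([]    , _ , _  , p) = p
  from (_ ∷ _ , _ , () , _)
boundedList? {P} P? b (suc L) =
  map′ to from (P? [] ⊎-dec anyUpTo? (λ x → boundedList? (λ xs → P? (x ∷ xs)) b L) b)
  where
  Split : Set
  Split = P [] ⊎ ∃ λ x → x < b × ExistsBoundedList (λ xs → P (x ∷ xs)) b L
  to : Split → ExistsBoundedList P b (suc L)
  to (inj₁ p)                              = [] , [] , z≤n , p
  to (inj₂ (x , x<b , xs , xs<b , len , p)) = x ∷ xs , x<b ∷ xs<b , s≤s len , p
  from : ExistsBoundedList P b (suc L) → Split
  from ([]     , _            , _       , p) = inj₁ p
  from (x ∷ xs , x<b ∷ xs<b , s≤s len , p) = inj₂ (x , x<b , xs , xs<b , len , p)

productSeqFromTo? : ∀ {m} → 1 ≤ m → ∀ n → Decidable (ProductSeqFromTo m n)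
productSeqFromTo? {m} 1≤m n s =
  map′ (λ (rest , _ , _ , seq) → rest , seq) bounded
       (boundedList? (λ rest → productSeq? 1≤m (n ∷ rest) ×-dec ≡-dec _≟_ (last (n ∷ rest)) (just s))
                     (suc s) (suc s * (m ∸ 1)))
  where
  bounded : ProductSeqFromTo m n s →
            ExistsBoundedList (λ rest → ProductSeq m (n ∷ rest) × last (n ∷ rest) ≡ just s)
                              (suc s) (suc s * (m ∸ 1))
  bounded (rest , seq , eq) with productSeq-bounded seq eq
  ... | _ ∷ rest<s , length≤ = rest , rest<s , ≤-trans (n≤1+n _) length≤ , seq , eq

least-satisfying : ∀ {P : ℕ → Set} → Decidable P → ∀ {n} → P n →
                   ∃ λ m → P m × (∀ {k} → P k → m ≤ k) × m ≤ n
least-satisfying {P} P? {n} pn = go n (<-wellFounded n) pn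
  where
  go : ∀ n → Acc _<_ n → P n → ∃ λ m → P m × (∀ {k} → P k → m ≤ k) × m ≤ n
  go n (acc smaller) pn with anyUpTo? P? n
  ... | yes (k , k<n , pk) =
    let m , pm , minimal , m≤k = go k (smaller k<n) pk in m , pm , minimal , ≤-trans m≤k (<⇒≤ k<n)
  ... | no none = n , pn , (λ pk → ≮⇒≥ λ k<n → none (_ , k<n , pk)) , ≤-refl

IsG-exists-≤ : ∀ {m n b} → 1 ≤ m → ReachesWithin m n b → ∃ λ s → IsG m n s × s ≤ b
IsG-exists-≤ {m} {n} 1≤m (_ , seq , s₀≤b) =
  let s , seq-s , minimal , s≤s₀ = least-satisfying (productSeqFromTo? 1≤m n) seq
  in  s , (seq-s , λ rest _ seq′ eq → minimal (rest , seq′ , eq)) , ≤-trans s≤s₀ s₀≤b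

runs : List (ℕ × ℕ) → List ℕ
runs []             = []
runs ((x , c) ∷ bs) = replicate c x ++ runs bs

product-replicate : ∀ c x → product (replicate c x) ≡ x ^ c
product-replicate zero    x = refl
product-replicate (suc c) x = cong (x *_) (product-replicate c x)

product-runs : ∀ bs → product (runs bs) ≡ foldr (λ (x , c) acc → x ^ c * acc) 1 bs
product-runs []             = refl
product-runs ((x , c) ∷ bs) =
  trans (product-++ (replicate c x) (runs bs))
        (cong₂ _*_ (product-replicate c x) (product-runs bs))

All-runs : ∀ {P : ℕ → Set} bs → All P (map proj₁ bs) → All P (runs bs)
All-runs []             []          = []
All-runs ((x , c) ∷ bs) (px ∷ pbs) = ++⁺ (replicate⁺ c px) (All-runs bs pbs)

allPairs-replicate : ∀ {R : ℕ → ℕ → Set} c {x} → R x x → AllPairs R (replicate c x)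
allPairs-replicate zero    r = []
allPairs-replicate (suc c) r = replicate⁺ c r ∷ allPairs-replicate c r

runs-allPairs : ∀ bs → AllPairs _<_ (map proj₁ bs) → AllPairs _≤_ (runs bs)
runs-allPairs []             []           = []
runs-allPairs ((x , c) ∷ bs) (x< ∷ bs<) =
  AllPairs.++⁺ (allPairs-replicate c ≤-refl) (runs-allPairs bs bs<)
               (replicate⁺ c (All-runs bs (All.map <⇒≤ x<)))

count-runs-≤ : ∀ {B} bs → AllPairs _<_ (map proj₁ bs) → All (λ (_ , c) → c ≤ B) bs →
               ∀ v → count v (runs bs) ≤ B
count-runs-≤ []             []           []            v = z≤n
count-runs-≤ {B} ((x , c) ∷ bs) (x< ∷ bs<) (c≤B ∷ cs≤B) v
  rewrite count-++ v (replicate c x) (runs bs) with x ≟ v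
... | yes refl = begin
  count x (replicate c x) + count x (runs bs) ≡⟨ cong (count x (replicate c x) +_) later-absent ⟩
  count x (replicate c x) + 0                 ≡⟨ +-identityʳ _ ⟩
  count x (replicate c x)                     ≤⟨ count-≤-length x (replicate c x) ⟩
  length (replicate c x)                      ≡⟨ length-replicate c ⟩
  c                                           ≤⟨ c≤B ⟩
  B                                           ∎
  where
  open ≤-Reasoning
  later-absent : count x (runs bs) ≡ 0
  later-absent = count-≡0 (runs bs) (All-runs bs (All.map >⇒≢ x<))
... | no x≢v rewrite count-≡0 (replicate c x) (replicate⁺ c x≢v) = count-runs-≤ bs bs< cs≤B v

runs-productSeq : ∀ {m} bs → Linked _<_ (map proj₁ bs) → All (λ (_ , c) → c ≤ m ∸ 1) bs →
                  (∃ λ R → product (runs bs) ≡ R ^ m) → ProductSeq m (runs bs)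
runs-productSeq bs increasing cs≤ isPower = record
  { sorted    = AllPairs⇒Sorted ≤-totalOrder (runs-allPairs bs bs<)
  ; isPower   = isPower
  ; multBound = All.tabulate (λ {v} _ → count-runs-≤ bs bs< cs≤ v)
  }
  where
  bs< : AllPairs _<_ (map proj₁ bs)
  bs< = Linked⇒AllPairs <-trans increasing

last-++ : ∀ {A : Set} (xs : List A) {ys : List A} {y : A} → last ys ≡ just y → last (xs ++ ys) ≡ just y
last-++ []       eq = eq
last-++ (x ∷ xs) {ys} eq with xs ++ ys | last-++ xs {ys} eq
... | []    | ()
... | _ ∷ _ | eq′ = eq′

last-runs : ∀ bs y c → last (runs (bs ++ (y , suc c) ∷ [])) ≡ just y
last-runs []             y zero    = refl
last-runs []             y (suc c) = last-runs [] y c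
last-runs ((x , c′) ∷ bs) y c       = last-++ (replicate c′ x) (last-runs bs y c)

-- The three shapes of sequence from 2^k

infix 8 2^_·3^_

2^_·3^_ : ℕ → ℕ → ℕ
2^ a ·3^ b = 2 ^ a * 3 ^ b

2^·3^-* : ∀ a b c d → 2^ a ·3^ b * 2^ c ·3^ d ≡ 2^ (a + c) ·3^ (b + d)
2^·3^-* a b c d = begin
  2 ^ a * 3 ^ b * (2 ^ c * 3 ^ d) ≡⟨ interchange (2 ^ a) (3 ^ b) (2 ^ c) (3 ^ d) ⟩
  2 ^ a * 2 ^ c * (3 ^ b * 3 ^ d) ≡⟨ sym (cong₂ _*_ (^-distribˡ-+-* 2 a c) (^-distribˡ-+-* 3 b d)) ⟩
  2 ^ (a + c) * 3 ^ (b + d)       ∎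
  where
  open ≡-Reasoning
  interchange : ∀ w x y z → w * x * (y * z) ≡ w * y * (x * z)
  interchange = solve-∀

2^·3^-^ : ∀ a b n → (2^ a ·3^ b) ^ n ≡ 2^ (a * n) ·3^ (b * n)
2^·3^-^ a b zero    rewrite *-zeroʳ a | *-zeroʳ b = refl
2^·3^-^ a b (suc n) rewrite *-suc a n | *-suc b n =
  trans (cong (2^ a ·3^ b *_) (2^·3^-^ a b n)) (2^·3^-* a b (a * n) (b * n))

reachesWithin-multiple : ∀ {p} q → 2 ≤ p → ReachesWithin p (2 ^ (q * p)) (2 ^ suc (q * p))
reachesWithin-multiple {p} q (s≤s 1≤p-1) =
  2 ^ (q * p) , (_ , seq , refl) , ^-monoʳ-≤ 2 (n≤1+n (q * p))
  where
  seq : ProductSeq p (2 ^ (q * p) ∷ [])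
  seq = runs-productSeq ((2 ^ (q * p) , 1) ∷ []) [-] (1≤p-1 ∷ [])
                        (2 ^ q , trans (*-identityʳ _) (sym (^-*-assoc 2 q p)))

reachesWithin-mid : ∀ r e q → let p = 3 + r + e; k = suc r + q * p in
                    ReachesWithin p (2 ^ k) (2 ^ suc k)
reachesWithin-mid r e q =
  2 ^ suc k , (_ , seq , last-runs ((2 ^ k , 2 + r) ∷ []) (2 ^ suc k) (suc e)) , ≤-refl
  where
  p k : ℕ
  p = 3 + r + e
  k = suc r + q * p
  bs : List (ℕ × ℕ)
  bs = (2 ^ k , 2 + r) ∷ (2 ^ suc k , 2 + e) ∷ []
  exponent : ∀ r e q → let p = 3 + r + e; k = suc r + q * p in
             k * (2 + r) + suc k * (2 + e) ≡ (q + suc k) * p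
  exponent = solve-∀
  power : product (runs bs) ≡ (2 ^ (q + suc k)) ^ p
  power = begin
    product (runs bs)                                 ≡⟨ product-runs bs ⟩
    (2 ^ k) ^ (2 + r) * ((2 ^ suc k) ^ (2 + e) * 1)   ≡⟨ cong ((2 ^ k) ^ (2 + r) *_) (*-identityʳ _) ⟩
    (2 ^ k) ^ (2 + r) * (2 ^ suc k) ^ (2 + e)         ≡⟨ cong₂ _*_ (^-*-assoc 2 k (2 + r)) (^-*-assoc 2 (suc k) (2 + e)) ⟩
    2 ^ (k * (2 + r)) * 2 ^ (suc k * (2 + e))         ≡⟨ sym (^-distribˡ-+-* 2 (k * (2 + r)) (suc k * (2 + e))) ⟩
    2 ^ (k * (2 + r) + suc k * (2 + e))               ≡⟨ cong (2 ^_) (exponent r e q) ⟩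
    2 ^ ((q + suc k) * p)                             ≡⟨ sym (^-*-assoc 2 (q + suc k) p) ⟩
    (2 ^ (q + suc k)) ^ p                             ∎
    where open ≡-Reasoning
  seq : ProductSeq p (runs bs)
  seq = runs-productSeq bs (^-monoʳ-< 2 (s≤s (s≤s z≤n)) (n<1+n k) ∷ [-])
                        (m≤m+n (2 + r) e ∷ s≤s (s≤s (m≤n+m e r)) ∷ []) (2 ^ (q + suc k) , power)

2^[4+m]<2^[3+m]·3 : ∀ m → 2 ^ (4 + m) < 2^ (3 + m) ·3^ 1
2^[4+m]<2^[3+m]·3 m = begin-strict
  2 ^ (4 + m)     ≡⟨ sixteen (2 ^ m) ⟩
  2 ^ m * 16      <⟨ *-monoʳ-< (2 ^ m) {{m^n≢0 2 m}} (m≤n+m 17 7) ⟩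
  2 ^ m * 24      ≡⟨ twenty-four (2 ^ m) ⟨
  2^ (3 + m) ·3^ 1 ∎
  where
  open ≤-Reasoning
  sixteen : ∀ t → 2 * (2 * (2 * (2 * t))) ≡ t * 16
  sixteen = solve-∀
  twenty-four : ∀ t → 2 * (2 * (2 * t)) * 3 ≡ t * 24
  twenty-four = solve-∀

2^[3+m]·3<2^m·27 : ∀ m → 2^ (3 + m) ·3^ 1 < 2^ m ·3^ 3
2^[3+m]·3<2^m·27 m = begin-strict
  2^ (3 + m) ·3^ 1 ≡⟨ twenty-four (2 ^ m) ⟩
  2 ^ m * 24      <⟨ *-monoʳ-< (2 ^ m) {{m^n≢0 2 m}} (m≤n+m 25 2) ⟩
  2^ m ·3^ 3       ∎
  where
  open ≤-Reasoning
  twenty-four : ∀ t → 2 * (2 * (2 * t)) * 3 ≡ t * 24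
  twenty-four = solve-∀

2^m·27≤2^[5+m] : ∀ m → 2^ m ·3^ 3 ≤ 2 ^ (5 + m)
2^m·27≤2^[5+m] m = begin
  2^ m ·3^ 3   ≤⟨ *-monoʳ-≤ (2 ^ m) (m≤m+n 27 5) ⟩
  2 ^ m * 32  ≡⟨ thirty-two (2 ^ m) ⟨
  2 ^ (5 + m) ∎
  where
  open ≤-Reasoning
  thirty-two : ∀ t → 2 * (2 * (2 * (2 * (2 * t)))) ≡ t * 32
  thirty-two = solve-∀

last-shape-product : ∀ d q → let p = 5 + d; m = d + q * p in
  2^ (4 + m) ·3^ 0 * ((2^ (3 + m) ·3^ 1) ^ (2 + d) * (2^ m ·3^ 3) ^ 1)
    ≡ (2^ (q * (4 + d) + d + 2) ·3^ 1) ^ p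
last-shape-product d q = begin
  2^ (4 + m) ·3^ 0 * ((2^ (3 + m) ·3^ 1) ^ (2 + d) * (2^ m ·3^ 3) ^ 1)
    ≡⟨ cong (2^ (4 + m) ·3^ 0 *_) (cong₂ _*_ (2^·3^-^ (3 + m) 1 (2 + d)) (2^·3^-^ m 3 1)) ⟩
  2^ (4 + m) ·3^ 0 * (2^ ((3 + m) * (2 + d)) ·3^ (1 * (2 + d)) * 2^ (m * 1) ·3^ (3 * 1))
    ≡⟨ cong (2^ (4 + m) ·3^ 0 *_) (2^·3^-* ((3 + m) * (2 + d)) (1 * (2 + d)) (m * 1) (3 * 1)) ⟩
  2^ (4 + m) ·3^ 0 * 2^ ((3 + m) * (2 + d) + m * 1) ·3^ (1 * (2 + d) + 3 * 1)
    ≡⟨ 2^·3^-* (4 + m) 0 ((3 + m) * (2 + d) + m * 1) (1 * (2 + d) + 3 * 1) ⟩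
  2^ (4 + m + ((3 + m) * (2 + d) + m * 1)) ·3^ (1 * (2 + d) + 3 * 1)
    ≡⟨ cong₂ 2^_·3^_ (twos d q) (threes d) ⟩
  2^ (E * p) ·3^ (1 * p)
    ≡⟨ 2^·3^-^ E 1 p ⟨
  (2^ E ·3^ 1) ^ p
    ∎
  where
  open ≡-Reasoning
  p m E : ℕ
  p = 5 + d
  m = d + q * p
  E = q * (4 + d) + d + 2
  twos : ∀ d q → let p = 5 + d; m = d + q * p in
         4 + m + ((3 + m) * (2 + d) + m * 1) ≡ (q * (4 + d) + d + 2) * p
  twos = solve-∀
  threes : ∀ d → 1 * (2 + d) + 3 * 1 ≡ 1 * (5 + d)
  threes = solve-∀

reachesWithin-last : ∀ d q → let p = 5 + d; k = 4 + d + q * p in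
                     ReachesWithin p (2 ^ k) (2 ^ suc k)
reachesWithin-last d q =
  Y , (_ , seq , last-runs ((2 ^ k , 1) ∷ (Z , 2 + d) ∷ []) Y 0) , 2^m·27≤2^[5+m] m
  where
  p m k Z Y E : ℕ
  p = 5 + d
  m = d + q * p
  k = 4 + m
  Z = 2^ (3 + m) ·3^ 1
  Y = 2^ m ·3^ 3
  E = q * (4 + d) + d + 2
  bs : List (ℕ × ℕ)
  bs = (2 ^ k , 1) ∷ (Z , 2 + d) ∷ (Y , 1) ∷ []
  power : product (runs bs) ≡ (2^ E ·3^ 1) ^ p
  power = trans (product-runs bs)
                (trans (cong (λ y → (2 ^ k) ^ 1 * (Z ^ (2 + d) * y)) (*-identityʳ (Y ^ 1)))
                       (last-shape-product d q))
  seq : ProductSeq p (runs bs)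
  seq = runs-productSeq bs (2^[4+m]<2^[3+m]·3 m ∷ 2^[3+m]·3<2^m·27 m ∷ [-])
                        (s≤s z≤n ∷ m≤n+m (2 + d) 2 ∷ s≤s z≤n ∷ []) (2^ E ·3^ 1 , power)

reachesWithin-residue : ∀ {p} q r → 5 ≤ p → r < p →
                        ReachesWithin p (2 ^ (r + q * p)) (2 ^ suc (r + q * p))
reachesWithin-residue q zero    5≤p _ = reachesWithin-multiple q (≤-trans (s≤s (s≤s z≤n)) 5≤p)
reachesWithin-residue q (suc r) 5≤p r<p with m≤n⇒m<n∨m≡n r<p
... | inj₁ r+1<p with m≤n⇒∃[o]m+o≡n r+1<p
...   | e , refl = reachesWithin-mid r e q
reachesWithin-residue q (suc r) 5≤p r<p | inj₂ refl with m≤n⇒∃[o]m+o≡n (s≤s⁻¹ (s≤s⁻¹ 5≤p))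
...   | d , refl = reachesWithin-last d q

reachesWithin-doubling : ∀ {p} → 5 ≤ p → ∀ k → ReachesWithin p (2 ^ k) (2 ^ suc k)
reachesWithin-doubling {p@(suc _)} 5≤p k =
  subst (λ k → ReachesWithin p (2 ^ k) (2 ^ suc k)) (sym (m≡m%n+[m/n]*n k p))
        (reachesWithin-residue (k / p) (k % p) 5≤p (m%n<n k p))

lemma4p7 : (p : ℕ) → Prime p → 5 ≤ p → (k : ℕ) →
    ∃ λ s → IsG p (2 ^ k) s × s ≤ 2 ^ suc k
lemma4p7 p _ 5≤p k = IsG-exists-≤ (≤-trans (s≤s z≤n) 5≤p) (reachesWithin-doubling 5≤p k)
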